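{- Let $a=a_1\ldots a_n$ and $b=b_1\ldots b_m$ be very odd sequences of lengths $n$ and $m$. Then $a\otimes b$ is a very odd sequence of length $2mn-n-m+1$. Moreover, if $a'$ and $b'$ are very odd sequences of lengths $n$ and $m$ respectively and $a\otimes b=a'\otimes b'$, then $a=a'$ and $b=b'$.
   Context: For a natural number $n$ and $a_1,\dots,a_n\in\{0,1\}$, put $A_k=\sum_{i=1}^{n-k}a_ia_{i+k}$ for $0\le k\le n-1$; the sequence is very odd if every $A_k$ ($0\le k\le n-1$) is odd. To a $0/1$ sequence $c_1\ldots c_N$ associate the polynomial $c(X)=\sum_{k=0}^{N-1}c_{k+1}X^k\in\mathbb F_2[X]$. For sequences $a$ of length $n$ and $b$ of length $m$ with associated polynomials $a(X),b(X)$, $a\otimes b$ is the $0/1$ sequence $c_1\ldots c_N$ of length $N=2mn-n-m+1$ whose associated polynomial is $a(X)\,b(X^{2n-1})$ (equivalently: replace each entry $b_i$ of $b$ by the block $a$ if $b_i=1$ and by $n$ zeros if $b_i=0$, and insert $n-1$ zeros between consecutive blocks). -}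

module Defs where

open import Data.Bool using (Bool; true; false; _∧_; _xor_)
open import Data.Nat using (ℕ; zero; suc; _+_; _*_; _∸_; _<_)
open import Data.Nat.Properties using (_<?_)
open import Data.Fin using (Fin; toℕ)
open import Data.Vec using (Vec; lookup; tabulate)
open import Relation.Nullary using (yes; no)

-- A 0/1 sequence of length n is a Vec Bool n (true = 1, false = 0);
-- entry a_{i+1} of the paper is  lookup a i  (0-based index i).

at : ∀ {n} → Vec Bool n → ℕ → Bool
at {n} a i with i <? n
... | yes i<n = lookup a (Data.Fin.fromℕ< i<n)
... | no _    = false

xorSum : ℕ → (ℕ → Bool) → Bool
xorSum zero    f = false
xorSum (suc k) f = xorSum k f xor f k

autocorrParity : ∀ {n} → Vec Bool n → ℕ → Bool
autocorrParity {n} a k = xorSum (n ∸ k) (λ i → at a i ∧ at a (i + k))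

VeryOdd : ∀ {n} → Vec Bool n → Set
VeryOdd {n} a = ∀ (k : ℕ) → k < n → autocorrParity a k ≡ true
  where open import Relation.Binary.PropositionalEquality using (_≡_)

-- polynomials over F_2 as coefficient functions ℕ → Bool
-- coefficient of X^j in  p(X) q(X)
polyMulCoeff : (ℕ → Bool) → (ℕ → Bool) → ℕ → Bool
polyMulCoeff p q j = xorSum (suc j) (λ i → p i ∧ q (j ∸ i))

substPow : ℕ → (ℕ → Bool) → ℕ → Bool
substPow d q j = xorSum (suc j) (λ i → q i ∧ eqℕ (i * d) j)
  where
  eqℕ : ℕ → ℕ → Bool
  eqℕ x y with Data.Nat._≟_ x y
  ... | yes _ = true
  ... | no _  = false

otimesLen : ℕ → ℕ → ℕ
otimesLen n m = (2 * m * n + 1) ∸ (n + m)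

-- a ⊗ b : the sequence of length 2mn-n-m+1 whose polynomial is a(X) b(X^{2n-1})
_⊗_ : ∀ {n m} → Vec Bool n → Vec Bool m → Vec Bool (otimesLen n m)
_⊗_ {n} {m} a b =
  tabulate (λ j → polyMulCoeff (at a) (substPow (2 * n ∸ 1) (at b)) (toℕ j))

{-# OPTIONS --safe #-}
module Submission where

-- Put d = 2n - 1 and c = a ⊗ b. As a(X) has degree < d, the copies of a in c = a(X) b(X^d) do
-- not overlap: position q d + r (r < d) of c carries a_r b_q. Write a shift as k = q d + r. A pair
-- (i, i + k) of nonzero positions of c with i = q₁ d + r₁ either joins offsets r₁ and r₁ + r of the
-- copies q₁ and q₁ + q, which needs r < n, or wraps around to offset r₁ - (d - r) of copy q₁ + q + 1,
-- which needs r ≥ n; since d = 2n - 1, exactly one of the two happens. Hence A_k(c) = A_r(a) A_q(b),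
-- resp. A_{d-r}(a) A_{q+1}(b), with all indices in range whenever k < 2mn - n - m + 1. A very odd
-- sequence starts with 1 (A_{n-1} = a_1 a_n is odd), so a can be read off the first d positions
-- of c and b off the positions q d, which gives injectivity.

open import Algebra.Bundles using (CommutativeMonoid)
open import Data.Bool using (Bool; true; false; _∧_; _xor_)
open import Data.Bool.Properties
  using (∧-comm; ∧-zeroʳ; ∧-identityʳ; ∧-conicalˡ; ∧-distribˡ-xor; ∧-distribʳ-xor;
         xor-assoc; xor-identityʳ; ∧-commutativeMonoid)
open import Data.Fin using (Fin; toℕ; fromℕ<)
open import Data.Fin.Properties using (toℕ<n; fromℕ<-toℕ; toℕ-fromℕ<)
open import Data.Nat
open import Data.Nat.Properties
open import Data.Nat.DivMod
  using (_/_; _%_; m≡m%n+[m/n]*n; m%n<n; [m+kn]%n≡m%n; m<n⇒m%n≡m; m*n%n≡0; %-remove-+ˡ)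
open import Data.Nat.Divisibility using (m%n≡0⇒n∣m)
open import Data.Nat.Tactic.RingSolver using (solve-∀)
open import Data.Product using (_×_; _,_)
open import Data.Vec using (Vec; lookup; tabulate)
open import Data.Vec.Properties using (lookup∘tabulate; tabulate∘lookup; tabulate-cong)
open import Function using (_∘_)
open import Relation.Binary.PropositionalEquality
open import Relation.Nullary using (Dec; yes; no; does; contradiction)
open import Relation.Nullary.Decidable using (dec-true; dec-false)
open import Defs

open import Algebra.Properties.CommutativeSemigroup
  (CommutativeMonoid.commutativeSemigroup ∧-commutativeMonoid) using (interchange)

open ≡-Reasoning

xorSum-cong : ∀ K {f g : ℕ → Bool} → (∀ i → i < K → f i ≡ g i) → xorSum K f ≡ xorSum K g
xorSum-cong zero    f≗g = refl
xorSum-cong (suc K) f≗g =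
  cong₂ _xor_ (xorSum-cong K (λ i i<K → f≗g i (m<n⇒m<1+n i<K))) (f≗g K (n<1+n K))

xorSum-false : ∀ K {f : ℕ → Bool} → (∀ i → i < K → f i ≡ false) → xorSum K f ≡ false
xorSum-false zero    f≡false = refl
xorSum-false (suc K) f≡false =
  cong₂ _xor_ (xorSum-false K (λ i i<K → f≡false i (m<n⇒m<1+n i<K))) (f≡false K (n<1+n K))

xorSum-+ : ∀ s t (f : ℕ → Bool) → xorSum (s + t) f ≡ xorSum s f xor xorSum t (λ i → f (s + i))
xorSum-+ s zero    f = trans (cong (λ K → xorSum K f) (+-identityʳ s)) (sym (xor-identityʳ _))
xorSum-+ s (suc t) f = begin
  xorSum (s + suc t) f                                        ≡⟨ cong (λ K → xorSum K f) (+-suc s t) ⟩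
  xorSum (s + t) f xor f (s + t)                              ≡⟨ cong (_xor f (s + t)) (xorSum-+ s t f) ⟩
  (xorSum s f xor xorSum t (λ i → f (s + i))) xor f (s + t)   ≡⟨ xor-assoc (xorSum s f) _ (f (s + t)) ⟩
  xorSum s f xor (xorSum t (λ i → f (s + i)) xor f (s + t))   ∎

xorSum-extend : ∀ {B K} {f : ℕ → Bool} → B ≤ K → (∀ i → B ≤ i → f i ≡ false) → xorSum K f ≡ xorSum B f
xorSum-extend {B} {K} {f} B≤K f≡false = begin
  xorSum K f                                            ≡⟨ cong (λ L → xorSum L f) (m+[n∸m]≡n B≤K) ⟨
  xorSum (B + (K ∸ B)) f                                ≡⟨ xorSum-+ B (K ∸ B) f ⟩
  xorSum B f xor xorSum (K ∸ B) (λ i → f (B + i))       ≡⟨ cong (xorSum B f xor_) tail≡false ⟩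
  xorSum B f xor false                                  ≡⟨ xor-identityʳ _ ⟩
  xorSum B f                                            ∎
  where
  tail≡false : xorSum (K ∸ B) (λ i → f (B + i)) ≡ false
  tail≡false = xorSum-false (K ∸ B) (λ i _ → f≡false (B + i) (m≤m+n B i))

xorSum-single : ∀ K t {f : ℕ → Bool} → t < K → (∀ i → i < K → i ≢ t → f i ≡ false) → xorSum K f ≡ f t
xorSum-single (suc K) t {f} t<1+K others with t ≟ K
... | yes refl = cong (_xor f t) (xorSum-false K (λ i i<t → others i (m<n⇒m<1+n i<t) (<⇒≢ i<t)))
... | no  t≢K  = begin
  xorSum K f xor f K   ≡⟨ cong₂ _xor_ (xorSum-single K t t<K othersBelowK) (others K (n<1+n K) (t≢K ∘ sym)) ⟩
  f t xor false        ≡⟨ xor-identityʳ _ ⟩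
  f t                  ∎
  where
  t<K : t < K
  t<K = ≤∧≢⇒< (s≤s⁻¹ t<1+K) t≢K
  othersBelowK : ∀ i → i < K → i ≢ t → f i ≡ false
  othersBelowK i i<K = others i (m<n⇒m<1+n i<K)

xorSum-∧ʳ : ∀ K (f : ℕ → Bool) x → xorSum K (λ i → f i ∧ x) ≡ xorSum K f ∧ x
xorSum-∧ʳ zero    f x = refl
xorSum-∧ʳ (suc K) f x =
  trans (cong (_xor (f K ∧ x)) (xorSum-∧ʳ K f x)) (sym (∧-distribʳ-xor x (xorSum K f) (f K)))

xorSum-∧ˡ : ∀ K x (f : ℕ → Bool) → xorSum K (λ i → x ∧ f i) ≡ x ∧ xorSum K f
xorSum-∧ˡ zero    x f = sym (∧-zeroʳ x)
xorSum-∧ˡ (suc K) x f =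
  trans (cong (_xor (x ∧ f K)) (xorSum-∧ˡ K x f)) (sym (∧-distribˡ-xor x (xorSum K f) (f K)))

xorSum-* : ∀ Q d (f : ℕ → Bool) → xorSum (Q * d) f ≡ xorSum Q (λ q → xorSum d (λ r → f (q * d + r)))
xorSum-* zero    d f = refl
xorSum-* (suc Q) d f = begin
  xorSum (d + Q * d) f                                  ≡⟨ cong (λ K → xorSum K f) (+-comm d (Q * d)) ⟩
  xorSum (Q * d + d) f                                  ≡⟨ xorSum-+ (Q * d) d f ⟩
  xorSum (Q * d) f xor xorSum d (λ r → f (Q * d + r))   ≡⟨ cong₂ _xor_ (xorSum-* Q d f) refl ⟩
  xorSum (suc Q) (λ q → xorSum d (λ r → f (q * d + r))) ∎

corr : ℕ → (ℕ → Bool) → ℕ → Bool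
corr K f k = xorSum K (λ i → f i ∧ f (i + k))

corr-blocks : ∀ M d (c : ℕ → Bool) k x (y : ℕ → Bool) →
              (∀ q → xorSum d (λ r → c (q * d + r) ∧ c (q * d + r + k)) ≡ x ∧ y q) →
              corr (M * d) c k ≡ x ∧ xorSum M y
corr-blocks M d c k x y block≡ = begin
  corr (M * d) c k                                                       ≡⟨ xorSum-* M d _ ⟩
  xorSum M (λ q → xorSum d (λ r → c (q * d + r) ∧ c (q * d + r + k)))   ≡⟨ xorSum-cong M (λ q _ → block≡ q) ⟩
  xorSum M (λ q → x ∧ y q)                                               ≡⟨ xorSum-∧ˡ M x y ⟩
  x ∧ xorSum M y                                                         ∎

at-≥ : ∀ {n} (a : Vec Bool n) {i} → n ≤ i → at a i ≡ false
at-≥ {n} a {i} n≤i with i <? n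
... | yes i<n = contradiction i<n (≤⇒≯ n≤i)
... | no  _   = refl

at-lookup : ∀ {n} (a : Vec Bool n) (i : Fin n) → at a (toℕ i) ≡ lookup a i
at-lookup {n} a i with toℕ i <? n
... | yes i<n = cong (lookup a) (fromℕ<-toℕ i i<n)
... | no  i≮n = contradiction (toℕ<n i) i≮n

at-tabulate : ∀ {n} (f : ℕ → Bool) {i} → i < n → at (tabulate {n = n} (f ∘ toℕ)) i ≡ f i
at-tabulate {n} f {i} i<n′ with i <? n
... | yes i<n = trans (lookup∘tabulate (f ∘ toℕ) (fromℕ< i<n)) (cong f (toℕ-fromℕ< i<n))
... | no  i≮n = contradiction i<n′ i≮n

at-injective : ∀ {n} {u v : Vec Bool n} → (∀ i → i < n → at u i ≡ at v i) → u ≡ v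
at-injective {u = u} {v} u≗v = begin
  u                    ≡⟨ tabulate∘lookup u ⟨
  tabulate (lookup u)  ≡⟨ tabulate-cong lookup≗ ⟩
  tabulate (lookup v)  ≡⟨ tabulate∘lookup v ⟩
  v                    ∎
  where
  lookup≗ : ∀ i → lookup u i ≡ lookup v i
  lookup≗ i = trans (sym (at-lookup u i)) (trans (u≗v (toℕ i) (toℕ<n i)) (at-lookup v i))

autocorrParity-extend : ∀ {n} (a : Vec Bool n) {k K} → n ∸ k ≤ K → autocorrParity a k ≡ corr K (at a) k
autocorrParity-extend {n} a {k} n∸k≤K = sym (xorSum-extend n∸k≤K beyond)
  where
  beyond : ∀ i → n ∸ k ≤ i → at a i ∧ at a (i + k) ≡ false
  beyond i n∸k≤i = trans (cong (at a i ∧_) (at-≥ a n≤i+k)) (∧-zeroʳ (at a i))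
    where
    n≤i+k : n ≤ i + k
    n≤i+k = ≤-trans (m≤n+m∸n n k) (≤-trans (+-monoʳ-≤ k n∸k≤i) (≤-reflexive (+-comm k i)))

VeryOdd⇒at0≡true : ∀ {n} (a : Vec Bool (suc n)) → VeryOdd a → at a 0 ≡ true
VeryOdd⇒at0≡true {n} a va = ∧-conicalˡ (at a 0) (at a n) (begin
  at a 0 ∧ at a n             ≡⟨ autocorrParity-extend a {n} (≤-reflexive (m+n∸n≡m 1 n)) ⟨
  autocorrParity a n          ≡⟨ va n (n<1+n n) ⟩
  true                        ∎)

private
  xorSum-decided : ∀ K d j (g : ℕ → Bool) (E : (x : ℕ) → Dec (x ≡ j) → Bool) →
                   (∀ x D → E x D ≡ does D) → ∀ {x} {D : Dec (x ≡ j)} → (x ≟ j) ≡ D →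
                   xorSum K (λ i → g i ∧ E (i * d) (i * d ≟ j)) xor (g K ∧ E x D)
                     ≡ xorSum K (λ i → g i ∧ does (i * d ≟ j)) xor (g K ∧ does (x ≟ j))
  xorSum-decided K d j g E E≗does refl =
    cong₂ _xor_ (xorSum-cong K (λ i _ → cong (g i ∧_) (E≗does (i * d) (i * d ≟ j))))
                (cong (g K ∧_) (E≗does _ _))

-- substPow tests i * d ≡ j with a function local to its where-block, which cannot be named here.
-- The metavariable `decide` stands for it; unification solves it only from an occurrence applied to
-- variables, which is why the index and the decision of the last summand are abstracted first.
substPow≡ : ∀ d g j → substPow d g j ≡ xorSum (suc j) (λ i → g i ∧ does (i * d ≟ j))
substPow≡ d g j = unfolded
  where
  decide : (x : ℕ) → Dec (x ≡ j) → Bool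
  decide = _
  decide≗does : ∀ x D → decide x D ≡ does D
  decide≗does _ (yes _) = refl
  decide≗does _ (no  _) = refl
  unfolded : substPow d g j ≡ xorSum (suc j) (λ i → g i ∧ does (i * d ≟ j))
  unfolded with j * d
  ... | x with x ≟ j in x≟j
  ... | _ = xorSum-decided j d j g decide decide≗does x≟j

substPow-multiple : ∀ {d} .{{_ : NonZero d}} g q → substPow d g (q * d) ≡ g q
substPow-multiple {d} g q = begin
  substPow d g (q * d)                                       ≡⟨ substPow≡ d g (q * d) ⟩
  xorSum (suc (q * d)) (λ i → g i ∧ does (i * d ≟ q * d))    ≡⟨ xorSum-single _ q (s≤s (m≤m*n q d)) others ⟩
  g q ∧ does (q * d ≟ q * d)                                 ≡⟨ cong (g q ∧_) (dec-true (q * d ≟ q * d) refl) ⟩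
  g q ∧ true                                                 ≡⟨ ∧-identityʳ (g q) ⟩
  g q                                                        ∎
  where
  others : ∀ i → i < suc (q * d) → i ≢ q → g i ∧ does (i * d ≟ q * d) ≡ false
  others i _ i≢q =
    trans (cong (g i ∧_) (dec-false (i * d ≟ q * d) (i≢q ∘ *-cancelʳ-≡ i q d))) (∧-zeroʳ (g i))

substPow-nonMultiple : ∀ {d} .{{_ : NonZero d}} g {k} → k % d ≢ 0 → substPow d g k ≡ false
substPow-nonMultiple {d} g {k} k%d≢0 = trans (substPow≡ d g k) (xorSum-false (suc k) vanishes)
  where
  vanishes : ∀ i → i < suc k → g i ∧ does (i * d ≟ k) ≡ false
  vanishes i _ = trans (cong (g i ∧_) (dec-false (i * d ≟ k) i*d≢k)) (∧-zeroʳ (g i))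
    where
    i*d≢k : i * d ≢ k
    i*d≢k i*d≡k = k%d≢0 (trans (cong (_% d) (sym i*d≡k)) (m*n%n≡0 i d))

[n∸m]%d≡0⇒n%d≡m : ∀ {m n d} .{{_ : NonZero d}} → m < d → m ≤ n → (n ∸ m) % d ≡ 0 → n % d ≡ m
[n∸m]%d≡0⇒n%d≡m {m} {n} {d} m<d m≤n [n∸m]%d≡0 = begin
  n % d              ≡⟨ cong (_% d) (m∸n+n≡m m≤n) ⟨
  (n ∸ m + m) % d    ≡⟨ %-remove-+ˡ m (m%n≡0⇒n∣m (n ∸ m) d [n∸m]%d≡0) ⟩
  m % d              ≡⟨ m<n⇒m%n≡m m<d ⟩
  m                  ∎

polyMulCoeff-substPow : ∀ {d} .{{_ : NonZero d}} {α : ℕ → Bool} (β : ℕ → Bool) q {r} →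
                        (∀ i → d ≤ i → α i ≡ false) → r < d →
                        polyMulCoeff α (substPow d β) (q * d + r) ≡ α r ∧ β q
polyMulCoeff-substPow {d} {α} β q {r} α-vanishes r<d =
  trans (xorSum-single (suc j) r (s≤s (m≤n+m r (q * d))) offDiagonal) diagonal
  where
  j : ℕ
  j = q * d + r
  j%d≡r : j % d ≡ r
  j%d≡r = trans (cong (_% d) (+-comm (q * d) r)) (trans ([m+kn]%n≡m%n r q d) (m<n⇒m%n≡m r<d))
  diagonal : α r ∧ substPow d β (j ∸ r) ≡ α r ∧ β q
  diagonal = cong (α r ∧_) (trans (cong (substPow d β) (m+n∸n≡m (q * d) r)) (substPow-multiple β q))
  offDiagonal : ∀ i → i < suc j → i ≢ r → α i ∧ substPow d β (j ∸ i) ≡ false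
  offDiagonal i i<1+j i≢r with d ≤? i
  ... | yes d≤i = cong (_∧ substPow d β (j ∸ i)) (α-vanishes i d≤i)
  ... | no  d≰i = trans (cong (α i ∧_) (substPow-nonMultiple β [j∸i]%d≢0)) (∧-zeroʳ (α i))
    where
    -- j ∸ i ≡ 0 (mod d) would give i ≡ j ≡ r (mod d), and both i and r are below d.
    [j∸i]%d≢0 : (j ∸ i) % d ≢ 0
    [j∸i]%d≢0 [j∸i]%d≡0 = i≢r (trans (sym ([n∸m]%d≡0⇒n%d≡m (≰⇒> d≰i) (s≤s⁻¹ i<1+j) [j∸i]%d≡0)) j%d≡r)

+-blocks : ∀ q₁ q r₁ r d → q₁ * d + r₁ + (q * d + r) ≡ (q₁ + q) * d + (r₁ + r)
+-blocks = solve-∀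

+-blocks-carry : ∀ q₁ q s t r → q₁ * (s + r) + (s + t) + (q * (s + r) + r) ≡ (q₁ + suc q) * (s + r) + t
+-blocks-carry = solve-∀

module _ {d N : ℕ} {α β : ℕ → Bool} (c : ℕ → Bool)
         (α-vanishes : ∀ i → N ≤ i → α i ≡ false)
         (c-blocks : ∀ q r → r < d → c (q * d + r) ≡ α r ∧ β q) where

  block-near : ∀ q₁ q r → r + N ≤ d →
               xorSum d (λ r₁ → c (q₁ * d + r₁) ∧ c (q₁ * d + r₁ + (q * d + r)))
                 ≡ corr d α r ∧ (β q₁ ∧ β (q₁ + q))
  block-near q₁ q r r+N≤d = trans (xorSum-cong d pair) (xorSum-∧ʳ d (λ r₁ → α r₁ ∧ α (r₁ + r)) _)
    where
    pair : ∀ r₁ → r₁ < d →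
           c (q₁ * d + r₁) ∧ c (q₁ * d + r₁ + (q * d + r)) ≡ (α r₁ ∧ α (r₁ + r)) ∧ (β q₁ ∧ β (q₁ + q))
    pair r₁ r₁<d with N ≤? r₁
    ... | yes N≤r₁ rewrite c-blocks q₁ r₁ r₁<d | α-vanishes r₁ N≤r₁ = refl
    ... | no  N≰r₁ = begin
      c (q₁ * d + r₁) ∧ c (q₁ * d + r₁ + (q * d + r))  ≡⟨ cong₂ _∧_ (c-blocks q₁ r₁ r₁<d) shifted ⟩
      (α r₁ ∧ β q₁) ∧ (α (r₁ + r) ∧ β (q₁ + q))        ≡⟨ interchange (α r₁) (β q₁) (α (r₁ + r)) (β (q₁ + q)) ⟩
      (α r₁ ∧ α (r₁ + r)) ∧ (β q₁ ∧ β (q₁ + q))        ∎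
      where
      r₁+r<d : r₁ + r < d
      r₁+r<d = <-≤-trans (+-monoˡ-< r (≰⇒> N≰r₁)) (≤-trans (≤-reflexive (+-comm N r)) r+N≤d)
      shifted : c (q₁ * d + r₁ + (q * d + r)) ≡ α (r₁ + r) ∧ β (q₁ + q)
      shifted = trans (cong c (+-blocks q₁ q r₁ r d)) (c-blocks (q₁ + q) (r₁ + r) r₁+r<d)

  block-far : ∀ q₁ q s r → N ≤ r → s + r ≡ d →
              xorSum d (λ r₁ → c (q₁ * d + r₁) ∧ c (q₁ * d + r₁ + (q * d + r)))
                ≡ corr r α s ∧ (β q₁ ∧ β (q₁ + suc q))
  block-far q₁ q s r N≤r s+r≡d = begin
    xorSum d F                                                       ≡⟨ cong (λ K → xorSum K F) s+r≡d ⟨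
    xorSum (s + r) F                                                 ≡⟨ xorSum-+ s r F ⟩
    xorSum s F xor xorSum r (λ t → F (s + t))                        ≡⟨ cong₂ _xor_ (xorSum-false s unpaired)
                                                                                    (xorSum-cong r wrapped) ⟩
    xorSum r (λ t → (α t ∧ α (t + s)) ∧ (β q₁ ∧ β (q₁ + suc q)))   ≡⟨ xorSum-∧ʳ r (λ t → α t ∧ α (t + s)) _ ⟩
    corr r α s ∧ (β q₁ ∧ β (q₁ + suc q))                             ∎
    where
    F : ℕ → Bool
    F r₁ = c (q₁ * d + r₁) ∧ c (q₁ * d + r₁ + (q * d + r))
    unpaired : ∀ r₁ → r₁ < s → F r₁ ≡ false
    unpaired r₁ r₁<s = trans (cong (c (q₁ * d + r₁) ∧_) (begin
      c (q₁ * d + r₁ + (q * d + r))  ≡⟨ cong c (+-blocks q₁ q r₁ r d) ⟩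
      c ((q₁ + q) * d + (r₁ + r))    ≡⟨ c-blocks (q₁ + q) (r₁ + r) (subst (r₁ + r <_) s+r≡d (+-monoˡ-< r r₁<s)) ⟩
      α (r₁ + r) ∧ β (q₁ + q)        ≡⟨ cong (_∧ β (q₁ + q)) (α-vanishes (r₁ + r) (≤-trans N≤r (m≤n+m r r₁))) ⟩
      false                          ∎)) (∧-zeroʳ (c (q₁ * d + r₁)))
    wrapped : ∀ t → t < r → F (s + t) ≡ (α t ∧ α (t + s)) ∧ (β q₁ ∧ β (q₁ + suc q))
    wrapped t t<r = begin
      F (s + t)                                      ≡⟨ cong₂ _∧_ (c-blocks q₁ (s + t) s+t<d) carried ⟩
      (α (s + t) ∧ β q₁) ∧ (α t ∧ β (q₁ + suc q))    ≡⟨ interchange (α (s + t)) (β q₁) (α t) (β (q₁ + suc q)) ⟩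
      (α (s + t) ∧ α t) ∧ (β q₁ ∧ β (q₁ + suc q))    ≡⟨ cong (_∧ (β q₁ ∧ β (q₁ + suc q))) swapped ⟩
      (α t ∧ α (t + s)) ∧ (β q₁ ∧ β (q₁ + suc q))    ∎
      where
      s+t<d : s + t < d
      s+t<d = subst (s + t <_) s+r≡d (+-monoʳ-< s t<r)
      carried : c (q₁ * d + (s + t) + (q * d + r)) ≡ α t ∧ β (q₁ + suc q)
      carried = trans (cong c (subst (λ e → q₁ * e + (s + t) + (q * e + r) ≡ (q₁ + suc q) * e + t)
                                     s+r≡d (+-blocks-carry q₁ q s t r)))
                      (c-blocks (q₁ + suc q) t (<-≤-trans t<r (subst (r ≤_) s+r≡d (m≤n+m r s))))
      swapped : α (s + t) ∧ α t ≡ α t ∧ α (t + s)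
      swapped = trans (∧-comm (α (s + t)) (α t)) (cong (λ u → α t ∧ α u) (+-comm s t))

  corr-blocks-near : ∀ M q r → r + N ≤ d → corr (M * d) c (q * d + r) ≡ corr d α r ∧ corr M β q
  corr-blocks-near M q r r+N≤d =
    corr-blocks M d c (q * d + r) (corr d α r) (λ q₁ → β q₁ ∧ β (q₁ + q)) (λ q₁ → block-near q₁ q r r+N≤d)

  corr-blocks-far : ∀ M q r → N ≤ r → r < d → corr (M * d) c (q * d + r) ≡ corr r α (d ∸ r) ∧ corr M β (suc q)
  corr-blocks-far M q r N≤r r<d =
    corr-blocks M d c (q * d + r) (corr r α (d ∸ r)) (λ q₁ → β q₁ ∧ β (q₁ + suc q))
                (λ q₁ → block-far q₁ q (d ∸ r) r N≤r (m∸n+n≡m (<⇒≤ r<d)))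

q*d+r<q′*d+r′⇒q<q′ : ∀ {q q′ r r′} d → r′ ≤ r → q * d + r < q′ * d + r′ → q < q′
q*d+r<q′*d+r′⇒q<q′ d r′≤r lt = ≰⇒> (λ q′≤q → <⇒≱ lt (+-mono-≤ (*-monoˡ-≤ d q′≤q) r′≤r))

stride : ℕ → ℕ
stride n = 2 * n ∸ 1

stride-suc : ∀ n → stride (suc n) ≡ n + suc n
stride-suc n = cong (λ x → n + suc x) (+-identityʳ n)

n≤stride : ∀ n → n ≤ stride n
n≤stride zero    = z≤n
n≤stride (suc n) = subst (suc n ≤_) (sym (stride-suc n)) (m≤n+m (suc n) n)

instance
  stride-nonZero : ∀ {n} → NonZero (stride (suc n))
  stride-nonZero {n} = >-nonZero (<-≤-trans z<s (n≤stride (suc n)))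

otimesLen-suc : ∀ n m → otimesLen (suc n) (suc m) ≡ m * stride (suc n) + suc n
otimesLen-suc n m = begin
  (2 * suc m * suc n + 1) ∸ (suc n + suc m)                       ≡⟨ cong (_∸ (suc n + suc m)) (expand n m) ⟩
  (m * (n + suc n) + suc n) + (suc n + suc m) ∸ (suc n + suc m)   ≡⟨ m+n∸n≡m _ (suc n + suc m) ⟩
  m * (n + suc n) + suc n                                         ≡⟨ cong (λ e → m * e + suc n) (stride-suc n) ⟨
  m * stride (suc n) + suc n                                      ∎
  where
  expand : ∀ n m → 2 * suc m * suc n + 1 ≡ (m * (n + suc n) + suc n) + (suc n + suc m)
  expand = solve-∀

module _ {n m : ℕ} (a : Vec Bool (suc n)) (b : Vec Bool (suc m)) where
  private
    d : ℕ
    d = stride (suc n)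
    1+n≤d : suc n ≤ d
    1+n≤d = n≤stride (suc n)
    d∸[1+n]≡n : d ∸ suc n ≡ n
    d∸[1+n]≡n = trans (cong (_∸ suc n) (stride-suc n)) (m+n∸n≡m n (suc n))
    otimesLen≤1+m*d : otimesLen (suc n) (suc m) ≤ suc m * d
    otimesLen≤1+m*d = subst (_≤ suc m * d) (sym (otimesLen-suc n m))
                            (≤-trans (+-monoʳ-≤ (m * d) 1+n≤d) (≤-reflexive (+-comm (m * d) d)))

  at-⊗ : ∀ q r → r < d → at (a ⊗ b) (q * d + r) ≡ at a r ∧ at b q
  at-⊗ q r r<d with otimesLen (suc n) (suc m) ≤? q * d + r
  ... | no  L≰j = trans (at-tabulate (polyMulCoeff (at a) (substPow d (at b))) (≰⇒> L≰j))
                        (polyMulCoeff-substPow (at b) q (λ i d≤i → at-≥ a (≤-trans 1+n≤d d≤i)) r<d)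
  ... | yes L≤j = trans (at-≥ (a ⊗ b) L≤j) (sym outside)
    where
    outside : at a r ∧ at b q ≡ false
    outside with suc n ≤? r | suc m ≤? q
    ... | yes 1+n≤r | _         = cong (_∧ at b q) (at-≥ a 1+n≤r)
    ... | no  _     | yes 1+m≤q = trans (cong (at a r ∧_) (at-≥ b 1+m≤q)) (∧-zeroʳ (at a r))
    ... | no  1+n≰r | no  1+m≰q = contradiction L≤j (<⇒≱ inside)
      where
      inside : q * d + r < otimesLen (suc n) (suc m)
      inside = subst (q * d + r <_) (sym (otimesLen-suc n m))
                     (+-mono-≤-< (*-monoˡ-≤ d (s≤s⁻¹ (≰⇒> 1+m≰q))) (≰⇒> 1+n≰r))

  private
    c : ℕ → Bool
    c = at (a ⊗ b)
    autocorrParity-⊗≡corr : ∀ k → autocorrParity (a ⊗ b) k ≡ corr (suc m * d) c k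
    autocorrParity-⊗≡corr k = autocorrParity-extend (a ⊗ b) (≤-trans (m∸n≤m _ k) otimesLen≤1+m*d)

  autocorrParity-⊗-near : ∀ q r → r < suc n →
                          autocorrParity (a ⊗ b) (q * d + r) ≡ autocorrParity a r ∧ autocorrParity b q
  autocorrParity-⊗-near q r r<1+n = begin
    autocorrParity (a ⊗ b) (q * d + r)         ≡⟨ autocorrParity-⊗≡corr (q * d + r) ⟩
    corr (suc m * d) c (q * d + r)             ≡⟨ corr-blocks-near c (λ _ → at-≥ a) at-⊗ (suc m) q r r+1+n≤d ⟩
    corr d (at a) r ∧ corr (suc m) (at b) q    ≡⟨ cong₂ _∧_ (autocorrParity-extend a {r} (≤-trans (m∸n≤m _ r) 1+n≤d))
                                                            (autocorrParity-extend b {q} (m∸n≤m _ q)) ⟨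
    autocorrParity a r ∧ autocorrParity b q    ∎
    where
    r+1+n≤d : r + suc n ≤ d
    r+1+n≤d = subst (r + suc n ≤_) (sym (stride-suc n)) (+-monoˡ-≤ (suc n) (s≤s⁻¹ r<1+n))

  autocorrParity-⊗-far : ∀ q r → suc n ≤ r → r < d →
                         autocorrParity (a ⊗ b) (q * d + r) ≡ autocorrParity a (d ∸ r) ∧ autocorrParity b (suc q)
  autocorrParity-⊗-far q r 1+n≤r r<d = begin
    autocorrParity (a ⊗ b) (q * d + r)                ≡⟨ autocorrParity-⊗≡corr (q * d + r) ⟩
    corr (suc m * d) c (q * d + r)                      ≡⟨ corr-blocks-far c (λ _ → at-≥ a) at-⊗ (suc m) q r 1+n≤r r<d ⟩
    corr r (at a) (d ∸ r) ∧ corr (suc m) (at b) (suc q) ≡⟨ cong₂ _∧_ (autocorrParity-extend a {d ∸ r} 1+n∸[d∸r]≤r)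
                                                                   (autocorrParity-extend b {suc q} (m∸n≤m _ (suc q))) ⟨
    autocorrParity a (d ∸ r) ∧ autocorrParity b (suc q) ∎
    where
    1+n∸[d∸r]≤r : suc n ∸ (d ∸ r) ≤ r
    1+n∸[d∸r]≤r = ≤-trans (∸-monoˡ-≤ (d ∸ r) 1+n≤d) (≤-reflexive (m∸[m∸n]≡n (<⇒≤ r<d)))

  ⊗-veryOdd : VeryOdd a → VeryOdd b → VeryOdd (a ⊗ b)
  ⊗-veryOdd va vb k k<L = subst (λ k → autocorrParity (a ⊗ b) k ≡ true) (sym k≡q*d+r)
                                (byRemainder (k / d) (k % d) (m%n<n k d) (subst (_< _) k≡q*d+r k<L))
    where
    k≡q*d+r : k ≡ k / d * d + k % d
    k≡q*d+r = trans (m≡m%n+[m/n]*n k d) (+-comm (k % d) (k / d * d))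
    byRemainder : ∀ q r → r < d → q * d + r < otimesLen (suc n) (suc m) →
                  autocorrParity (a ⊗ b) (q * d + r) ≡ true
    byRemainder q r r<d j<L with suc n ≤? r
    ... | no  1+n≰r = trans (autocorrParity-⊗-near q r r<1+n) (cong₂ _∧_ (va r r<1+n) (vb q q<1+m))
      where
      r<1+n : r < suc n
      r<1+n = ≰⇒> 1+n≰r
      q<1+m : q < suc m
      q<1+m = q*d+r<q′*d+r′⇒q<q′ d z≤n
                (subst (q * d + r <_) (sym (+-identityʳ _)) (<-≤-trans j<L otimesLen≤1+m*d))
    ... | yes 1+n≤r = trans (autocorrParity-⊗-far q r 1+n≤r r<d)
                            (cong₂ _∧_ (va (d ∸ r) d∸r<1+n) (vb (suc q) (s<s q<m)))
      where
      q<m : q < m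
      q<m = q*d+r<q′*d+r′⇒q<q′ d 1+n≤r (subst (q * d + r <_) (otimesLen-suc n m) j<L)
      d∸r<1+n : d ∸ r < suc n
      d∸r<1+n = s≤s (≤-trans (∸-monoʳ-≤ d 1+n≤r) (≤-reflexive d∸[1+n]≡n))

⊗-injective : ∀ {n m} {a a′ : Vec Bool (suc n)} {b b′ : Vec Bool (suc m)} →
              at a 0 ≡ true → at a′ 0 ≡ true → at b 0 ≡ true → at b′ 0 ≡ true →
              a ⊗ b ≡ a′ ⊗ b′ → a ≡ a′ × b ≡ b′
⊗-injective {n} {m} {a} {a′} {b} {b′} a₀ a′₀ b₀ b′₀ a⊗b≡a′⊗b′ = at-injective a≗a′ , at-injective b≗b′
  where
  d : ℕ
  d = stride (suc n)
  a≗a′ : ∀ i → i < suc n → at a i ≡ at a′ i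
  a≗a′ i i<1+n = begin
    at a i                 ≡⟨ ∧-identityʳ (at a i) ⟨
    at a i ∧ true          ≡⟨ cong (at a i ∧_) b₀ ⟨
    at a i ∧ at b 0        ≡⟨ at-⊗ a b 0 i i<d ⟨
    at (a ⊗ b) i           ≡⟨ cong (λ c → at c i) a⊗b≡a′⊗b′ ⟩
    at (a′ ⊗ b′) i         ≡⟨ at-⊗ a′ b′ 0 i i<d ⟩
    at a′ i ∧ at b′ 0      ≡⟨ cong (at a′ i ∧_) b′₀ ⟩
    at a′ i ∧ true         ≡⟨ ∧-identityʳ (at a′ i) ⟩
    at a′ i                ∎
    where
    i<d : i < d
    i<d = <-≤-trans i<1+n (n≤stride (suc n))
  b≗b′ : ∀ q → q < suc m → at b q ≡ at b′ q
  b≗b′ q _ = begin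
    at b q                 ≡⟨ cong (_∧ at b q) a₀ ⟨
    at a 0 ∧ at b q        ≡⟨ at-⊗ a b q 0 (>-nonZero⁻¹ d) ⟨
    at (a ⊗ b) (q * d + 0)   ≡⟨ cong (λ c → at c (q * d + 0)) a⊗b≡a′⊗b′ ⟩
    at (a′ ⊗ b′) (q * d + 0) ≡⟨ at-⊗ a′ b′ q 0 (>-nonZero⁻¹ d) ⟩
    at a′ 0 ∧ at b′ q      ≡⟨ cong (_∧ at b′ q) a′₀ ⟩
    at b′ q                ∎

lemma3 : ∀ (n m : ℕ) (a a′ : Vec Bool (suc n)) (b b′ : Vec Bool (suc m))
           → VeryOdd a → VeryOdd b
           → VeryOdd (a ⊗ b)
             × (VeryOdd a′ → VeryOdd b′ → a ⊗ b ≡ a′ ⊗ b′ → (a ≡ a′) × (b ≡ b′))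
lemma3 n m a a′ b b′ va vb = ⊗-veryOdd a b va vb , λ va′ vb′ →
  ⊗-injective (VeryOdd⇒at0≡true a va) (VeryOdd⇒at0≡true a′ va′)
              (VeryOdd⇒at0≡true b vb) (VeryOdd⇒at0≡true b′ vb′)
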